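{- Let $k\ge 2$ and let $\mathcal{H}=(V,E)$ be the $k$-uniform threshold hypergraph given by a binary sequence $(b_1,\dots,b_n)_k$. Then for all $x,y\in V$, either $y\ll x$ or $x\ll y$.
   Context: Let $k\ge 2$ and $n$ be positive integers and let $(b_1,\dots,b_n)_k$ be a binary sequence ($b_i\in\{0,1\}$) with $b_1=\dots=b_{k-1}=0$. The $k$-uniform threshold hypergraph $\mathcal{H}=(V,E)$ given by this sequence has vertex set $V=\{v_1,\dots,v_n\}$, and a set $e$ is an edge if and only if $e$ is a $k$-element subset of $V$ and $b_j=1$, where $j=\max\{i: v_i\in e\}$. For $x,y\in V$, write $x\ll y$ if $x$ can be replaced by $y$ in any edge: for every $(k-1)$-element subset $\{x_1,\dots,x_{k-1}\}\subseteq V\setminus\{x,y\}$, if $\{x,x_1,\dots,x_{k-1}\}\in E$ then $\{y,x_1,\dots,x_{k-1}\}\in E$. -}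

module Defs where

open import Data.Nat using (ℕ; suc; _≤_; _<_; _∸_)
open import Data.Fin using (Fin; toℕ)
open import Data.Fin.Subset using (Subset; _∈_; _∉_; _∪_; ⁅_⁆; ∣_∣)
open import Data.Bool using (Bool; true; false)
open import Data.Product using (Σ; _×_; ∃-syntax)
open import Relation.Binary.PropositionalEquality using (_≡_)

-- Vertices v_1,…,v_n are represented by Fin n (v_i ↦ index i-1).
-- A binary sequence (b_1,…,b_n) is a function Fin n → Bool.

ValidSeq : (k n : ℕ) → (Fin n → Bool) → Set
ValidSeq k n b = (i : Fin n) → toℕ i < k ∸ 1 → b i ≡ false

IsMax : {n : ℕ} → Subset n → Fin n → Set
IsMax {n} e j = j ∈ e × ((i : Fin n) → i ∈ e → toℕ i ≤ toℕ j)

IsEdge : (k n : ℕ) → (Fin n → Bool) → Subset n → Set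
IsEdge k n b e = (∣ e ∣ ≡ k) × (∃[ j ] (IsMax e j × (b j ≡ true)))

Dominated : (k n : ℕ) → (Fin n → Bool) → Fin n → Fin n → Set
Dominated k n b x y =
  (S : Subset n) → ∣ S ∣ ≡ k ∸ 1 → x ∉ S → y ∉ S →
  IsEdge k n b (⁅ x ⁆ ∪ S) → IsEdge k n b (⁅ y ⁆ ∪ S)

module Submission where

-- An edge is decided by its maximal vertex alone. Let x < y. If b_y = 1, replacing x by y in
-- an edge leaves a set whose maximum is either y itself or the old maximum, both with bit 1,
-- so x ≪ y. If b_y = 0, an edge through y has its maximum m > y in the rest of the edge, and
-- replacing y by the smaller x keeps m as the maximum, so y ≪ x. Hence ≪ is total.

open import Defs
open import Data.Nat using (ℕ; suc; _≤_)
open import Data.Fin using (Fin; zero; suc; toℕ; _<_)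
open import Data.Fin.Properties using (<-cmp; ≤-refl; ≤-trans)
open import Data.Nat.Properties using (<⇒≤)
open import Data.Fin.Subset using (Subset; _∈_; _∉_; _∪_; ⁅_⁆; ∣_∣; inside; outside)
open import Data.Fin.Subset.Properties using (x∈⁅x⁆; x∈⁅y⁆⇒x≡y; x∈p∪q⁻; x∈p∪q⁺; ∪-identityˡ)
open import Data.Vec using (_∷_; here; there)
open import Data.Bool using (Bool; true; false)
open import Data.Sum using (_⊎_; inj₁; inj₂; swap)
open import Data.Product using (_,_; _×_; ∃-syntax)
open import Data.Empty using (⊥-elim)
open import Relation.Binary.Definitions using (tri<; tri≈; tri>)
open import Relation.Binary.PropositionalEquality using (_≡_; refl; sym; trans; cong)

∣⁅x⁆∪p∣≡suc∣p∣ : ∀ {n} (x : Fin n) (p : Subset n) → x ∉ p → ∣ ⁅ x ⁆ ∪ p ∣ ≡ suc ∣ p ∣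
∣⁅x⁆∪p∣≡suc∣p∣ zero    (inside  ∷ p) x∉p = ⊥-elim (x∉p here)
∣⁅x⁆∪p∣≡suc∣p∣ zero    (outside ∷ p) x∉p = cong (λ q → suc ∣ q ∣) (∪-identityˡ p)
∣⁅x⁆∪p∣≡suc∣p∣ (suc x) (inside  ∷ p) x∉p = cong suc (∣⁅x⁆∪p∣≡suc∣p∣ x p (λ x∈p → x∉p (there x∈p)))
∣⁅x⁆∪p∣≡suc∣p∣ (suc x) (outside ∷ p) x∉p = ∣⁅x⁆∪p∣≡suc∣p∣ x p (λ x∈p → x∉p (there x∈p))

∣⁅x⁆∪p∣≡∣⁅y⁆∪p∣ : ∀ {n} (x y : Fin n) (p : Subset n) → x ∉ p → y ∉ p →
  ∣ ⁅ x ⁆ ∪ p ∣ ≡ ∣ ⁅ y ⁆ ∪ p ∣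
∣⁅x⁆∪p∣≡∣⁅y⁆∪p∣ x y p x∉p y∉p = trans (∣⁅x⁆∪p∣≡suc∣p∣ x p x∉p) (sym (∣⁅x⁆∪p∣≡suc∣p∣ y p y∉p))

x∈⁅y⁆∪p⁻ : ∀ {n} {x : Fin n} (y : Fin n) (p : Subset n) → x ∈ ⁅ y ⁆ ∪ p → x ≡ y ⊎ x ∈ p
x∈⁅y⁆∪p⁻ y p x∈ with x∈p∪q⁻ ⁅ y ⁆ p x∈
... | inj₁ x∈⁅y⁆ = inj₁ (x∈⁅y⁆⇒x≡y y x∈⁅y⁆)
... | inj₂ x∈p   = inj₂ x∈p

IsMax-⁅x⁆∪ : ∀ {n} (x m : Fin n) (p : Subset n) → m ∈ ⁅ x ⁆ ∪ p →
  toℕ x ≤ toℕ m → (∀ i → i ∈ p → toℕ i ≤ toℕ m) → IsMax (⁅ x ⁆ ∪ p) m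
IsMax-⁅x⁆∪ x m p m∈ x≤m p≤m = m∈ , bound
  where
  bound : ∀ i → i ∈ ⁅ x ⁆ ∪ p → toℕ i ≤ toℕ m
  bound i i∈ with x∈⁅y⁆∪p⁻ x p i∈
  ... | inj₁ refl = x≤m
  ... | inj₂ i∈p  = p≤m i i∈p

IsMax-new : ∀ {n} (x : Fin n) (p : Subset n) → (∀ i → i ∈ p → toℕ i ≤ toℕ x) →
  IsMax (⁅ x ⁆ ∪ p) x
IsMax-new x p = IsMax-⁅x⁆∪ x x p (x∈p∪q⁺ (inj₁ (x∈⁅x⁆ x))) ≤-refl

IsMax-replace : ∀ {n} (x y m : Fin n) (p : Subset n) → IsMax (⁅ x ⁆ ∪ p) m → m ∈ p →
  toℕ y ≤ toℕ m → IsMax (⁅ y ⁆ ∪ p) m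
IsMax-replace x y m p (_ , bound) m∈p y≤m =
  IsMax-⁅x⁆∪ y m p (x∈p∪q⁺ (inj₂ m∈p)) y≤m (λ i i∈p → bound i (x∈p∪q⁺ (inj₂ i∈p)))

module _ (k n : ℕ) (b : Fin n → Bool) where

  ≪-refl : ∀ x → Dominated k n b x x
  ≪-refl x S _ _ _ edge = edge

  ≪-later-if-set : ∀ {x y} → x < y → b y ≡ true → Dominated k n b x y
  ≪-later-if-set {x} {y} x<y by≡1 S _ x∉S y∉S (∣e∣≡k , m , max@(m∈ , bound) , bm≡1) =
    trans (∣⁅x⁆∪p∣≡∣⁅y⁆∪p∣ y x S y∉S x∉S) ∣e∣≡k , max-of-e'
    where
    y-is-max : m < y → IsMax (⁅ y ⁆ ∪ S) y
    y-is-max m<y = IsMax-new y S (λ i i∈S → ≤-trans (bound i (x∈p∪q⁺ (inj₂ i∈S))) (<⇒≤ m<y))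

    max-of-e' : ∃[ j ] (IsMax (⁅ y ⁆ ∪ S) j × b j ≡ true)
    max-of-e' with x∈⁅y⁆∪p⁻ x S m∈
    ... | inj₁ refl = y , y-is-max x<y , by≡1
    ... | inj₂ m∈S with <-cmp m y
    ...   | tri< m<y _ _  = y , y-is-max m<y , by≡1
    ...   | tri≈ _ refl _ = ⊥-elim (y∉S m∈S)
    ...   | tri> _ _ y<m  = m , IsMax-replace x y m S max m∈S (<⇒≤ y<m) , bm≡1

  ≪-earlier-if-unset : ∀ {x y} → x < y → b y ≡ false → Dominated k n b y x
  ≪-earlier-if-unset {x} {y} x<y by≡0 S _ y∉S x∉S (∣e∣≡k , m , max@(m∈ , bound) , bm≡1)
    with x∈⁅y⁆∪p⁻ y S m∈
  ... | inj₁ refl with () ← trans (sym bm≡1) by≡0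
  ... | inj₂ m∈S =
    trans (∣⁅x⁆∪p∣≡∣⁅y⁆∪p∣ x y S x∉S y∉S) ∣e∣≡k , m ,
    IsMax-replace y x m S max m∈S (≤-trans (<⇒≤ x<y) (bound y (x∈p∪q⁺ (inj₁ (x∈⁅x⁆ y))))) ,
    bm≡1

  ≪-total-< : ∀ {x y} → x < y → Dominated k n b y x ⊎ Dominated k n b x y
  ≪-total-< {y = y} x<y with b y in by
  ... | true  = inj₂ (≪-later-if-set x<y by)
  ... | false = inj₁ (≪-earlier-if-unset x<y by)

proposition1 : (k n : ℕ) → 2 ≤ k → (b : Fin n → Bool) → ValidSeq k n b →
    (x y : Fin n) → Dominated k n b y x ⊎ Dominated k n b x y
proposition1 k n _ b _ x y with <-cmp x y
... | tri< x<y _ _ = ≪-total-< k n b x<y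
... | tri≈ _ refl _ = inj₁ (≪-refl k n b x)
... | tri> _ _ y<x = swap (≪-total-< k n b y<x)
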